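{- Let $\lambda$ and $\mu$ be weak compositions. Then $\mu$ is the content of a weak composition tableau of shape $\lambda$ if and only if $\mathrm{flat}(\mu)$ refines $\mathrm{flat}(\lambda)$ and $\mu$ dominates $\lambda$.
   Context: A weak composition is a finite sequence of nonnegative integers; $\mathrm{flat}(\mu)$ deletes its zeros. A composition $\alpha=(\alpha_1,\dots,\alpha_p)$ refines $\beta=(\beta_1,\dots,\beta_q)$ if there are $0=i_0<i_1<\dots<i_q=p$ with $\alpha_{i_{j-1}+1}+\dots+\alpha_{i_j}=\beta_j$ for all $j$. $\mu$ dominates $\lambda$ if $\mu_1+\dots+\mu_i\ge\lambda_1+\dots+\lambda_i$ for all $i$ (missing entries counted as $0$). The diagram of $\lambda$ has $\lambda_r$ left-justified boxes in row $r$ (possibly empty rows). A weak composition tableau of shape $\lambda$ is a filling of the boxes with positive integers, weakly increasing when read left to right within rows and top to bottom, such that every entry in row $r$ is strictly smaller than every entry in row $r'$ whenever $r<r'$, and every entry in row $r$ is at most $r$. Its content is the weak composition whose $j$-th entry is the number of entries equal to $j$. -}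

module Defs where

open import Data.Nat using (ℕ; zero; suc; _≤_; _<_; _≟_)
open import Data.List using (List; []; _∷_; filter; length; map; take; concat)
open import Data.Nat.ListAction using (sum)
open import Data.List.Relation.Unary.All using (All)
open import Data.List.Relation.Unary.AllPairs using (AllPairs)
open import Data.List.Membership.Propositional using (_∈_)
open import Data.Product using (Σ; _×_; ∃-syntax)
open import Relation.Binary.PropositionalEquality using (_≡_)
open import Relation.Nullary using (¬_)

WeakComp : Set
WeakComp = List ℕ

flat : WeakComp → List ℕ
flat = filter (λ n → ¬? (n ≟ 0))
  where open import Relation.Nullary.Decidable using (¬?)

-- 1-indexed entry, 0 beyond the length (and at index 0).
at : List ℕ → ℕ → ℕ
at []       _             = 0
at (x ∷ xs) zero          = 0
at (x ∷ xs) (suc zero)    = x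
at (x ∷ xs) (suc (suc j)) = at xs (suc j)

NonEmpty : List ℕ → Set
NonEmpty xs = ¬ (xs ≡ [])

Refines : List ℕ → List ℕ → Set
Refines α β = ∃[ bs ] (All NonEmpty bs × concat bs ≡ α × map sum bs ≡ β)

Dominates : WeakComp → WeakComp → Set
Dominates μ λ′ = ∀ i → sum (take i λ′) ≤ sum (take i μ)

-- A filling is a list of rows (row r is the r-th list, 1-indexed).
Filling : Set
Filling = List (List ℕ)

rowAt : Filling → ℕ → List ℕ
rowAt []       _             = []
rowAt (x ∷ xs) zero          = []
rowAt (x ∷ xs) (suc zero)    = x
rowAt (x ∷ xs) (suc (suc j)) = rowAt xs (suc j)

record IsWCT (λ′ : WeakComp) (T : Filling) : Set where
  field
    shape      : map length T ≡ λ′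
    positive   : ∀ r x → x ∈ rowAt T r → 1 ≤ x
    bounded    : ∀ r x → x ∈ rowAt T r → x ≤ r
    rowWeak    : ∀ r → AllPairs _≤_ (rowAt T r)
    rowsStrict : ∀ r r′ x y → r < r′ → x ∈ rowAt T r → y ∈ rowAt T r′ → x < y

count : Filling → ℕ → ℕ
count T j = sum (map (λ row → length (filter (_≟ j) row)) T)

IsContent : WeakComp → Filling → Set
IsContent μ T = ∀ j → 1 ≤ j → at μ j ≡ count T j

{-# OPTIONS --safe #-}
-- Read row by row, a weak composition tableau is the weakly increasing word 1^μ₁ 2^μ₂ … cut
-- into rows of lengths λ₁, λ₂, …, so it is unique when it exists. Strictness between rows says
-- that no value is split between two nonempty rows, i.e. flat μ refines flat λ; the bound
-- "entries of row r are at most r" says μ₁ + … + μᵣ ≥ λ₁ + … + λᵣ. The proof peels the tableau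
-- apart one step at a time: an empty first row, a value lo + 1 that does not occur, or the entry
-- lo + 1 that must start a nonempty first row. Each step acts on λ, μ, the refinement and the
-- dominance in matching ways; lo counts the values used up and hi is the index of the current
-- first row, and dominance is then measured against λ preceded by hi − lo − 1 zero parts.
module Submission where

open import Defs
open import Data.List using (List; []; _∷_; _++_; filter; length; map; take)
open import Data.List.Membership.Propositional using (_∈_)
open import Data.List.Properties using (filter-accept; filter-reject; filter-none; ∷-injectiveˡ; ∷-injectiveʳ)
open import Data.List.Relation.Unary.All as All using (All; []; _∷_)
open import Data.List.Relation.Unary.All.Properties using (++⁻ˡ)
open import Data.List.Relation.Unary.AllPairs using (AllPairs; []; _∷_)
open import Data.Nat using (ℕ; zero; suc; _+_; _≤_; _<_; _≟_; z≤n; s≤s; s≤s⁻¹; z<s)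
open import Data.Nat.ListAction using (sum)
open import Data.Nat.Properties
open import Data.Product using (∃-syntax; _×_; _,_; proj₁; proj₂; map₂)
open import Data.Product.Function.NonDependent.Propositional using (_×-⇔_)
open import Data.Unit using (⊤; tt)
open import Function.Base using (id; _∘_)
open import Function.Bundles using (_⇔_; mk⇔; Equivalence)
import Function.Properties.Equivalence as ⇔
open import Relation.Binary.PropositionalEquality
open import Relation.Nullary using (¬_; yes; no; contradiction)

open Equivalence using (to; from)

both-absurd : ∀ {A B : Set} → ¬ A → ¬ B → A ⇔ B
both-absurd ¬a ¬b = mk⇔ (λ a → contradiction a ¬a) (λ b → contradiction b ¬b)

both-reduce : ∀ {A A′ B B′ : Set} → A ⇔ A′ → B ⇔ B′ → A′ ⇔ B′ → A ⇔ B
both-reduce a b a′⇔b′ = ⇔.trans a (⇔.trans a′⇔b′ (⇔.sym b))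

countRow : List ℕ → ℕ → ℕ
countRow R y = length (filter (_≟ y) R)

countRow-∷-≡ : ∀ {y} R → countRow (y ∷ R) y ≡ suc (countRow R y)
countRow-∷-≡ {y} R = cong length (filter-accept (_≟ y) refl)

countRow-∷-≢ : ∀ {x y} R → x ≢ y → countRow (x ∷ R) y ≡ countRow R y
countRow-∷-≢ {y = y} R x≢y = cong length (filter-reject (_≟ y) x≢y)

countRow-≡0 : ∀ R y → countRow R y ≡ 0 ⇔ All (_≢ y) R
countRow-≡0 R y = mk⇔ (absent R) (cong length ∘ filter-none (_≟ y))
  where
    absent : ∀ R → countRow R y ≡ 0 → All (_≢ y) R
    absent [] _ = []
    absent (x ∷ R) c with x ≟ y
    ... | yes refl = contradiction (trans (sym (countRow-∷-≡ {y} R)) c) (λ ())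
    ... | no x≢y   = x≢y ∷ absent R (trans (sym (countRow-∷-≢ R x≢y)) c)

count-≡0 : ∀ T y → count T y ≡ 0 ⇔ All (All (_≢ y)) T
count-≡0 []      y = mk⇔ (λ _ → []) (λ _ → refl)
count-≡0 (R ∷ T) y = mk⇔
  (λ c → to (countRow-≡0 R y) (m+n≡0⇒m≡0 _ c) ∷ to (count-≡0 T y) (m+n≡0⇒n≡0 _ c))
  (λ { (r ∷ rs) → cong₂ _+_ (from (countRow-≡0 R y) r) (from (count-≡0 T y) rs) })

count-above : ∀ {T y} → All (All (y <_)) T → count T y ≡ 0
count-above {T} {y} a = from (count-≡0 T y) (All.map (All.map >⇒≢) a)

count-∷-≡ : ∀ {y} R T → count ((y ∷ R) ∷ T) y ≡ suc (count (R ∷ T) y)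
count-∷-≡ {y} R T = cong (_+ count T y) (countRow-∷-≡ R)

count-∷-≢ : ∀ {x y} R T → x ≢ y → count ((x ∷ R) ∷ T) y ≡ count (R ∷ T) y
count-∷-≢ {y = y} R T x≢y = cong (_+ count T y) (countRow-∷-≢ R x≢y)

-- μ lists the multiplicities of the values lo + 1, lo + 2, … in T.
Content : ℕ → WeakComp → Filling → Set
Content lo []      T = ∀ x → lo < x → count T x ≡ 0
Content lo (m ∷ μ) T = count T (suc lo) ≡ m × Content (suc lo) μ T

content-cong : ∀ lo μ {T T′} → (∀ x → lo < x → count T x ≡ count T′ x) →
               Content lo μ T → Content lo μ T′
content-cong lo []      eq c x lo<x = trans (sym (eq x lo<x)) (c x lo<x)
content-cong lo (m ∷ μ) eq (c₁ , c) =
  trans (sym (eq (suc lo) ≤-refl)) c₁ , content-cong (suc lo) μ (λ x → eq x ∘ <⇒≤) c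

content-[] : ∀ lo μ → Content lo μ [] ⇔ All (_≡ 0) μ
content-[] lo []      = mk⇔ (λ _ → []) (λ _ _ _ → refl)
content-[] lo (m ∷ μ) = mk⇔
  (λ (c₁ , c) → sym c₁ ∷ to (content-[] (suc lo) μ) c)
  (λ { (m≡0 ∷ z) → sym m≡0 , from (content-[] (suc lo) μ) z })

content-∷ : ∀ lo m μ R T →
            Content lo (suc m ∷ μ) ((suc lo ∷ R) ∷ T) ⇔ Content lo (m ∷ μ) (R ∷ T)
content-∷ lo m μ R T = mk⇔
  (λ (c₁ , c) → suc-injective (trans (sym (count-∷-≡ R T)) c₁) , content-cong (suc lo) μ rest c)
  (λ (c₁ , c) → trans (count-∷-≡ R T) (cong suc c₁) , content-cong (suc lo) μ (λ x → sym ∘ rest x) c)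
  where
    rest : ∀ x → suc lo < x → count ((suc lo ∷ R) ∷ T) x ≡ count (R ∷ T) x
    rest x = count-∷-≢ R T ∘ <⇒≢

content⇔at : ∀ lo μ T → Content lo μ T ⇔ (∀ j → at μ (suc j) ≡ count T (lo + suc j))
content⇔at lo [] T = mk⇔
  (λ c j → sym (c (lo + suc j) (m<m+n lo z<s)))
  (λ c x lo<x → let (o , lo+o≡x) = m≤n⇒∃[o]m+o≡n lo<x in
     sym (trans (c o) (cong (count T) (trans (+-suc lo o) lo+o≡x))))
content⇔at lo (m ∷ μ) T = mk⇔
  (λ { (c₁ , c) zero → trans (sym c₁) (cong (count T) (+-comm 1 lo))
     ; (c₁ , c) (suc j) → trans (to ih c j) (cong (count T) (sym (+-suc lo (suc j)))) })
  (λ c → trans (cong (count T) (+-comm 1 lo)) (sym (c 0))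
       , from ih (λ j → trans (c (suc j)) (cong (count T) (+-suc lo (suc j)))))
  where
    ih : Content (suc lo) μ T ⇔ (∀ j → at μ (suc j) ≡ count T (suc lo + suc j))
    ih = content⇔at (suc lo) μ T

-- Tableaux with rows numbered from hi and entries above lo

Separated : List ℕ → List ℕ → Set
Separated R R′ = All (λ x → All (x <_) R′) R

RowsFrom : (ℕ → List ℕ → Set) → ℕ → Filling → Set
RowsFrom P k []      = ⊤
RowsFrom P k (R ∷ T) = P k R × RowsFrom P (suc k) T

record IsTableau (lo hi : ℕ) (λ′ : WeakComp) (T : Filling) : Set where
  constructor tableau
  field
    shape     : map length T ≡ λ′
    above     : All (All (lo <_)) T
    bounded   : RowsFrom (λ r → All (_≤ r)) hi T
    sorted    : All (AllPairs _≤_) T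
    separated : AllPairs Separated T

HasTableau : ℕ → ℕ → WeakComp → WeakComp → Set
HasTableau lo hi λ′ μ = ∃[ T ] (IsTableau lo hi λ′ T × Content lo μ T)

above-suc : ∀ {lo T} → All (All (lo <_)) T → All (All (_≢ suc lo)) T → All (All (suc lo <_)) T
above-suc a a′ = All.zipWith (All.zipWith (λ (lo<x , x≢) → ≤∧≢⇒< lo<x (x≢ ∘ sym))) (a , a′)

head-minimal : ∀ {lo hi λ′ x R T} → IsTableau lo hi λ′ ((x ∷ R) ∷ T) →
               All (All (x ≤_)) ((x ∷ R) ∷ T)
head-minimal (tableau _ _ _ ((x≤R ∷ _) ∷ _) (sep ∷ _)) =
  (≤-refl ∷ x≤R) ∷ All.map (All.map <⇒≤ ∘ All.head) sep

head-≡ : ∀ {lo hi λ′ x R T} → IsTableau lo hi λ′ ((x ∷ R) ∷ T) →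
         count ((x ∷ R) ∷ T) (suc lo) ≢ 0 → x ≡ suc lo
head-≡ {lo} {x = x} t@(tableau _ ((lo<x ∷ _) ∷ _) _ _ _) occurs = ≤-antisym (≮⇒≥ x≯lo+1) lo<x
  where
    x≯lo+1 : ¬ suc lo < x
    x≯lo+1 lo+1<x = occurs (count-above (All.map (All.map (<-≤-trans lo+1<x)) (head-minimal t)))

drop-head : ∀ {lo hi n λ′ x R T} → IsTableau lo hi (suc n ∷ λ′) ((x ∷ R) ∷ T) →
            IsTableau lo hi (n ∷ λ′) (R ∷ T)
drop-head (tableau sh ((_ ∷ a) ∷ as) ((_ ∷ b) , bs) ((_ ∷ s) ∷ ss) (p ∷ ps)) =
  tableau (cong₂ _∷_ (suc-injective (∷-injectiveˡ sh)) (∷-injectiveʳ sh))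
          (a ∷ as) (b , bs) (s ∷ ss) (All.map All.tail p ∷ ps)

push-head : ∀ {lo hi n λ′ R T} → lo < hi → All (All (suc lo <_)) T →
            IsTableau lo hi (n ∷ λ′) (R ∷ T) → IsTableau lo hi (suc n ∷ λ′) ((suc lo ∷ R) ∷ T)
push-head lo<hi later (tableau sh (a ∷ as) (b , bs) (s ∷ ss) (p ∷ ps)) =
  tableau (cong₂ _∷_ (cong suc (∷-injectiveˡ sh)) (∷-injectiveʳ sh))
          ((≤-refl ∷ a) ∷ as) ((lo<hi ∷ b) , bs) ((a ∷ s) ∷ ss)
          (All.zipWith (λ (q , r) → q ∷ r) (later , p) ∷ ps)

-- Later rows exceed the first entry of R or, if R is empty, avoid lo + 1 because then m = 0.
later-above : ∀ {lo hi n λ′ m R T} → (n ≡ 0 → m ≡ 0) → IsTableau lo hi (n ∷ λ′) (R ∷ T) →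
              count (R ∷ T) (suc lo) ≡ m → All (All (suc lo <_)) T
later-above {R = []} n≡0⇒m≡0 (tableau refl (_ ∷ a) _ _ _) c =
  above-suc a (to (count-≡0 _ _) (trans c (n≡0⇒m≡0 refl)))
later-above {R = x ∷ R} _ (tableau _ ((lo<x ∷ _) ∷ _) _ _ (p ∷ _)) _ =
  All.map (All.map (≤-<-trans lo<x) ∘ All.head) p

hasTableau-[] : ∀ lo hi μ → HasTableau lo hi [] μ ⇔ All (_≡ 0) μ
hasTableau-[] lo hi μ = mk⇔
  (λ { ([] , _ , c) → to (content-[] lo μ) c })
  (λ z → [] , tableau refl [] tt [] [] , from (content-[] lo μ) z)

hasTableau-0∷ : ∀ lo hi λ′ μ → HasTableau lo hi (0 ∷ λ′) μ ⇔ HasTableau lo (suc hi) λ′ μ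
hasTableau-0∷ lo hi λ′ μ = mk⇔
  (λ { (([] ∷ T) , tableau sh (_ ∷ a) (_ , b) (_ ∷ s) (_ ∷ p) , c) →
         T , tableau (∷-injectiveʳ sh) a b s p , content-cong lo μ (λ _ _ → refl) c })
  (λ (T , tableau sh a b s p , c) →
     ([] ∷ T) , tableau (cong (0 ∷_) sh) ([] ∷ a) ([] , b) ([] ∷ s) (All.universal (λ _ → []) T ∷ p)
              , content-cong lo μ (λ _ _ → refl) c)

hasTableau-0∷ʳ : ∀ lo hi λ′ μ → HasTableau lo hi λ′ (0 ∷ μ) ⇔ HasTableau (suc lo) hi λ′ μ
hasTableau-0∷ʳ lo hi λ′ μ = mk⇔
  (λ (T , tableau sh a b s p , (c₀ , c)) →
     T , tableau sh (above-suc a (to (count-≡0 T (suc lo)) c₀)) b s p , c)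
  (λ (T , tableau sh a b s p , c) →
     T , tableau sh (All.map (All.map <⇒≤) a) b s p , (count-above a , c))

hasTableau-suc : ∀ {lo hi n λ′ m μ} → lo < hi → (n ≡ 0 → m ≡ 0) →
                 HasTableau lo hi (suc n ∷ λ′) (suc m ∷ μ) ⇔ HasTableau lo hi (n ∷ λ′) (m ∷ μ)
hasTableau-suc {lo} {hi} {n} {λ′} {m} {μ} lo<hi n≡0⇒m≡0 = mk⇔ pop push
  where
    pop : HasTableau lo hi (suc n ∷ λ′) (suc m ∷ μ) → HasTableau lo hi (n ∷ λ′) (m ∷ μ)
    pop (((x ∷ R) ∷ T) , t , c@(c₁ , _)) with head-≡ t (λ c≡0 → 0≢1+n (trans (sym c≡0) c₁))
    ... | refl = (R ∷ T) , drop-head t , to (content-∷ lo m μ R T) c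
    push : HasTableau lo hi (n ∷ λ′) (m ∷ μ) → HasTableau lo hi (suc n ∷ λ′) (suc m ∷ μ)
    push ((R ∷ T) , t , c@(c₁ , _)) =
      ((suc lo ∷ R) ∷ T) , push-head lo<hi (later-above n≡0⇒m≡0 t c₁) t , from (content-∷ lo m μ R T) c

¬hasTableau-∷-[] : ∀ {lo hi n λ′} → ¬ HasTableau lo hi (suc n ∷ λ′) []
¬hasTableau-∷-[] (((x ∷ R) ∷ T) , tableau _ ((lo<x ∷ _) ∷ _) _ _ _ , c) =
  All.head (All.head (to (count-≡0 ((x ∷ R) ∷ T) x) (c x lo<x))) refl

-- With hi = lo + 1 the first row can only hold copies of lo + 1.
¬hasTableau-0∷ʳ : ∀ {lo n λ′ μ} → ¬ HasTableau lo (suc lo) (suc n ∷ λ′) (0 ∷ μ)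
¬hasTableau-0∷ʳ (((x ∷ R) ∷ T) , tableau _ ((lo<x ∷ _) ∷ _) ((x≤lo+1 ∷ _) , _) _ _ , (c₀ , _)) =
  All.head (All.head (to (count-≡0 ((x ∷ R) ∷ T) _) c₀)) (≤-antisym x≤lo+1 lo<x)

¬hasTableau-1∷ : ∀ {lo hi λ′ m μ} → ¬ HasTableau lo hi (1 ∷ λ′) (suc (suc m) ∷ μ)
¬hasTableau-1∷ (((x ∷ []) ∷ T) , t , (c₁ , _)) with head-≡ t (λ c≡0 → 0≢1+n (trans (sym c≡0) c₁))
¬hasTableau-1∷ {lo} {m = m} (((x ∷ []) ∷ T) , tableau _ _ _ _ (p ∷ _) , (c₁ , _)) | refl =
  0≢1+n (sym (suc-injective (begin
    suc (suc m)                        ≡⟨ sym c₁ ⟩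
    count ((suc lo ∷ []) ∷ T) (suc lo) ≡⟨ count-∷-≡ [] T ⟩
    suc (count T (suc lo))             ≡⟨ cong suc (count-above (All.map All.head p)) ⟩
    1                                  ∎)))
  where open ≡-Reasoning

-- Refinement

refines-[] : ∀ F → Refines F [] ⇔ F ≡ []
refines-[] F = mk⇔ (λ { ([] , _ , F≡[] , _) → sym F≡[] }) (λ { refl → [] , [] , refl , refl })

¬refines-[]-∷ : ∀ {y G} → ¬ Refines [] (y ∷ G)
¬refines-[]-∷ (([] ∷ _) , ([]≢[] ∷ _) , _) = []≢[] refl

refines-∷ : ∀ x F y G →
            Refines (x ∷ F) (y ∷ G) ⇔
            (∃[ b ] ∃[ F′ ] (F ≡ b ++ F′ × x + sum b ≡ y × Refines F′ G))
refines-∷ x F y G = mk⇔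
  (λ { (([] ∷ _) , ([]≢[] ∷ _) , _) → contradiction refl []≢[]
     ; (((_ ∷ b) ∷ bs) , (_ ∷ ne) , refl , refl) → b , _ , refl , refl , bs , ne , refl , refl })
  (λ { (b , _ , refl , refl , bs , ne , refl , refl) → ((x ∷ b) ∷ bs) , ((λ ()) ∷ ne) , refl , refl })

refines-suc : ∀ {x F y G} → Refines (suc x ∷ F) (suc y ∷ G) ⇔ Refines (x ∷ F) (y ∷ G)
refines-suc {x} {F} {y} {G} = ⇔.trans (refines-∷ (suc x) F (suc y) G) (⇔.trans
  (mk⇔ (map₂ (map₂ (map₂ (λ (s , r) → suc-injective s , r))))
       (map₂ (map₂ (map₂ (λ (s , r) → cong suc s , r)))))
  (⇔.sym (refines-∷ x F y G)))

refines-0∷ : ∀ {F y G} → Refines (0 ∷ F) (suc y ∷ G) ⇔ Refines F (suc y ∷ G)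
refines-0∷ {F} {y} {G} = mk⇔ merged (split F)
  where
    merged : Refines (0 ∷ F) (suc y ∷ G) → Refines F (suc y ∷ G)
    merged r with to (refines-∷ 0 F (suc y) G) r
    ... | (c ∷ b) , F′ , refl , s , r′ =
      from (refines-∷ c (b ++ F′) (suc y) G) (b , F′ , refl , s , r′)
    split : ∀ F → Refines F (suc y ∷ G) → Refines (0 ∷ F) (suc y ∷ G)
    split []       r = contradiction r ¬refines-[]-∷
    split (c ∷ F₀) r with to (refines-∷ c F₀ (suc y) G) r
    ... | b , F′ , refl , s , r′ =
      from (refines-∷ 0 (c ∷ b ++ F′) (suc y) G) ((c ∷ b) , F′ , refl , s , r′)

sum≡0⇒≡[] : ∀ {b} → All (_≢ 0) b → sum b ≡ 0 → b ≡ []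
sum≡0⇒≡[] []        _ = refl
sum≡0⇒≡[] (x≢0 ∷ _) s = contradiction (m+n≡0⇒m≡0 _ s) x≢0

refines-0∷0∷ : ∀ {F G} → All (_≢ 0) F → Refines (0 ∷ F) (0 ∷ G) ⇔ Refines F G
refines-0∷0∷ {F} {G} nz = mk⇔ dropped (λ r → from (refines-∷ 0 F 0 G) ([] , F , refl , refl , r))
  where
    dropped : Refines (0 ∷ F) (0 ∷ G) → Refines F G
    dropped r with to (refines-∷ 0 F 0 G) r
    ... | b , F′ , refl , s , r′ with sum≡0⇒≡[] (++⁻ˡ b nz) s
    ...   | refl = r′

¬refines-suc-0 : ∀ {x F G} → ¬ Refines (suc x ∷ F) (0 ∷ G)
¬refines-suc-0 {x} {F} {G} r with to (refines-∷ (suc x) F 0 G) r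
... | _ , _ , _ , () , _

flat-nonzero : ∀ μ → All (_≢ 0) (flat μ)
flat-nonzero []          = []
flat-nonzero (zero ∷ μ)  = flat-nonzero μ
flat-nonzero (suc m ∷ μ) = (λ ()) ∷ flat-nonzero μ

flat-≡[] : ∀ μ → flat μ ≡ [] ⇔ All (_≡ 0) μ
flat-≡[] []          = mk⇔ (λ _ → []) (λ _ → refl)
flat-≡[] (zero ∷ μ)  = ⇔.trans (flat-≡[] μ) (mk⇔ (refl ∷_) All.tail)
flat-≡[] (suc m ∷ μ) = both-absurd (λ ()) (λ { (() ∷ _) })

refines-flat : ∀ m μ n λ′ → (n ≡ 0 → m ≡ 0) →
               Refines (m ∷ flat μ) (n ∷ flat λ′) ⇔ Refines (flat (m ∷ μ)) (flat (n ∷ λ′))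
refines-flat zero    μ zero    λ′ _        = refines-0∷0∷ (flat-nonzero μ)
refines-flat zero    μ (suc n) λ′ _        = refines-0∷
refines-flat (suc m) μ zero    λ′ n≡0⇒m≡0 = contradiction (n≡0⇒m≡0 refl) (λ ())
refines-flat (suc m) μ (suc n) λ′ _        = ⇔.refl

-- Dominance

-- μ dominates λ′ preceded by d zero parts.
DominatesShifted : ℕ → WeakComp → WeakComp → Set
DominatesShifted d μ λ′ = ∀ i → sum (take i λ′) ≤ sum (take (d + i) μ)

dominatesShifted-[] : ∀ d μ → DominatesShifted d μ []
dominatesShifted-[] d μ zero    = z≤n
dominatesShifted-[] d μ (suc i) = z≤n

dominatesShifted-0∷ : ∀ d μ λ′ → DominatesShifted d μ (0 ∷ λ′) ⇔ DominatesShifted (suc d) μ λ′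
dominatesShifted-0∷ d μ λ′ = mk⇔
  (λ dom i → subst (λ k → sum (take i λ′) ≤ sum (take k μ)) (+-suc d i) (dom (suc i)))
  (λ { dom zero → z≤n
     ; dom (suc i) → subst (λ k → sum (take i λ′) ≤ sum (take k μ)) (sym (+-suc d i)) (dom i) })

sum-take-+-suc : ∀ d i x μ → sum (take (d + suc i) (x ∷ μ)) ≡ x + sum (take (d + i) μ)
sum-take-+-suc d i x μ = cong (λ k → sum (take k (x ∷ μ))) (+-suc d i)

dominatesShifted-suc : ∀ d m μ n λ′ → DominatesShifted d (suc m ∷ μ) (suc n ∷ λ′) ⇔
                                      DominatesShifted d (m ∷ μ) (n ∷ λ′)
dominatesShifted-suc d m μ n λ′ = mk⇔
  (λ { dom zero → z≤n
     ; dom (suc i) → subst (_ ≤_) (sym (sum-take-+-suc d i m μ))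
                               (s≤s⁻¹ (subst (_ ≤_) (sum-take-+-suc d i (suc m) μ) (dom (suc i)))) })
  (λ { dom zero → z≤n
     ; dom (suc i) → subst (_ ≤_) (sym (sum-take-+-suc d i (suc m) μ))
                               (s≤s (subst (_ ≤_) (sum-take-+-suc d i m μ) (dom (suc i)))) })

¬dominatesShifted-0∷ : ∀ {μ n λ′} → ¬ DominatesShifted 0 (0 ∷ μ) (suc n ∷ λ′)
¬dominatesShifted-0∷ dom with dom 1
... | ()

Criterion : ℕ → WeakComp → WeakComp → Set
Criterion d λ′ μ = Refines (flat μ) (flat λ′) × DominatesShifted d μ λ′

criterion-[] : ∀ d μ → Criterion d [] μ ⇔ All (_≡ 0) μ
criterion-[] d μ = mk⇔
  (λ (r , _) → to (flat-≡[] μ) (to (refines-[] (flat μ)) r))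
  (λ z → from (refines-[] (flat μ)) (from (flat-≡[] μ) z) , dominatesShifted-[] d μ)

criterion-0∷ : ∀ d λ′ μ → Criterion d (0 ∷ λ′) μ ⇔ Criterion (suc d) λ′ μ
criterion-0∷ d λ′ μ = ⇔.refl ×-⇔ dominatesShifted-0∷ d μ λ′

criterion-suc : ∀ {d n λ′ m μ} → (n ≡ 0 → m ≡ 0) →
                Criterion d (suc n ∷ λ′) (suc m ∷ μ) ⇔ Criterion d (n ∷ λ′) (m ∷ μ)
criterion-suc {d} {n} {λ′} {m} {μ} n≡0⇒m≡0 =
  ⇔.trans refines-suc (refines-flat m μ n λ′ n≡0⇒m≡0) ×-⇔ dominatesShifted-suc d m μ n λ′

¬criterion-∷-[] : ∀ {d n λ′} → ¬ Criterion d (suc n ∷ λ′) []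
¬criterion-∷-[] = ¬refines-[]-∷ ∘ proj₁

¬criterion-0∷ʳ : ∀ {n λ′ μ} → ¬ Criterion 0 (suc n ∷ λ′) (0 ∷ μ)
¬criterion-0∷ʳ = ¬dominatesShifted-0∷ ∘ proj₂

¬criterion-1∷ : ∀ {d λ′ m μ} → ¬ Criterion d (1 ∷ λ′) (suc (suc m) ∷ μ)
¬criterion-1∷ = ¬refines-suc-0 ∘ to refines-suc ∘ proj₁

hasTableau⇔criterion : ∀ lo d λ′ μ → HasTableau lo (suc (d + lo)) λ′ μ ⇔ Criterion d λ′ μ
hasTableau⇔criterion lo d [] μ =
  both-reduce (hasTableau-[] lo _ μ) (criterion-[] d μ) ⇔.refl
hasTableau⇔criterion lo d (0 ∷ λ′) μ =
  both-reduce (hasTableau-0∷ lo _ λ′ μ) (criterion-0∷ d λ′ μ) (hasTableau⇔criterion lo (suc d) λ′ μ)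
hasTableau⇔criterion lo d (suc n ∷ λ′) [] =
  both-absurd ¬hasTableau-∷-[] (¬criterion-∷-[] {d})
hasTableau⇔criterion lo zero (suc n ∷ λ′) (0 ∷ μ) =
  both-absurd ¬hasTableau-0∷ʳ (¬criterion-0∷ʳ {μ = μ})
hasTableau⇔criterion lo (suc d) (suc n ∷ λ′) (0 ∷ μ) =
  both-reduce (hasTableau-0∷ʳ lo _ (suc n ∷ λ′) μ) ⇔.refl
    (subst (λ hi → HasTableau (suc lo) hi (suc n ∷ λ′) μ ⇔ Criterion d (suc n ∷ λ′) μ)
           (cong suc (+-suc d lo)) (hasTableau⇔criterion (suc lo) d (suc n ∷ λ′) μ))
hasTableau⇔criterion lo d (1 ∷ λ′) (suc (suc m) ∷ μ) =
  both-absurd ¬hasTableau-1∷ (¬criterion-1∷ {d} {μ = μ})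
hasTableau⇔criterion lo d (1 ∷ λ′) (1 ∷ μ) =
  both-reduce (hasTableau-suc (s≤s (m≤n+m lo d)) (λ _ → refl)) (criterion-suc {d} {μ = μ} (λ _ → refl))
              (hasTableau⇔criterion lo d (0 ∷ λ′) (0 ∷ μ))
hasTableau⇔criterion lo d (suc (suc n) ∷ λ′) (suc m ∷ μ) =
  both-reduce (hasTableau-suc (s≤s (m≤n+m lo d)) (λ ())) (criterion-suc {d} {μ = μ} (λ ()))
              (hasTableau⇔criterion lo d (suc n ∷ λ′) (m ∷ μ))

-- Row indices versus lists of rows

rowAt-zero : ∀ T → rowAt T 0 ≡ []
rowAt-zero []      = refl
rowAt-zero (_ ∷ _) = refl

RowsFrom-suc : ∀ P k T → RowsFrom (λ r → P (suc r)) k T ≡ RowsFrom P (suc k) T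
RowsFrom-suc P k []      = refl
RowsFrom-suc P k (R ∷ T) = cong (P (suc k) R ×_) (RowsFrom-suc P (suc k) T)

RowsFrom-const : ∀ {P : List ℕ → Set} k T → RowsFrom (λ _ → P) k T ⇔ All P T
RowsFrom-const k []      = mk⇔ (λ _ → []) (λ _ → tt)
RowsFrom-const k (R ∷ T) = mk⇔
  (λ (p , ps) → p ∷ to (RowsFrom-const (suc k) T) ps)
  (λ { (p ∷ ps) → p , from (RowsFrom-const (suc k) T) ps })

∀-rowAt⇔RowsFrom : ∀ {P : ℕ → List ℕ → Set} T → (∀ r → P r []) →
                   (∀ r → P r (rowAt T r)) ⇔ RowsFrom P 1 T
∀-rowAt⇔RowsFrom []      P[] = mk⇔ (λ _ → tt) (λ _ → P[])
∀-rowAt⇔RowsFrom {P} (R ∷ T) P[] = mk⇔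
  (λ rows → rows 1 , subst id (RowsFrom-suc P 1 T) (to ih (λ
     { zero    → subst (P 1) (sym (rowAt-zero T)) (P[] 1)
     ; (suc r) → rows (suc (suc r)) })))
  (λ { _ zero → P[] 0
     ; (p , _) (suc zero) → p
     ; (_ , ps) (suc (suc r)) → from ih (subst id (sym (RowsFrom-suc P 1 T)) ps) (suc r) })
  where
    ih : (∀ r → P (suc r) (rowAt T r)) ⇔ RowsFrom (λ r → P (suc r)) 1 T
    ih = ∀-rowAt⇔RowsFrom T (P[] ∘ suc)

∀-rowAt⇔All : ∀ {P : List ℕ → Set} T → P [] → (∀ r → P (rowAt T r)) ⇔ All P T
∀-rowAt⇔All T P[] = ⇔.trans (∀-rowAt⇔RowsFrom T (λ _ → P[])) (RowsFrom-const 1 T)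

∀-∈-rowAt⇔RowsFrom : ∀ {Q : ℕ → ℕ → Set} T →
                     (∀ r x → x ∈ rowAt T r → Q r x) ⇔ RowsFrom (λ r → All (Q r)) 1 T
∀-∈-rowAt⇔RowsFrom T = ⇔.trans
  (mk⇔ (λ q r → All.tabulate (q r _)) (λ a r x → All.lookup (a r)))
  (∀-rowAt⇔RowsFrom T (λ _ → []))

OrderedRows : Filling → Set
OrderedRows T = ∀ r r′ x y → r < r′ → x ∈ rowAt T r → y ∈ rowAt T r′ → x < y

ordered⇔separated : ∀ T → OrderedRows T ⇔ AllPairs Separated T
ordered⇔separated []      = mk⇔ (λ _ → []) (λ { _ _ _ _ _ _ () })
ordered⇔separated (R ∷ T) = mk⇔ separated ordered
  where
    sep[] : Separated R []
    sep[] = All.universal (λ _ → []) R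
    ordered : AllPairs Separated (R ∷ T) → OrderedRows (R ∷ T)
    ordered (sepR ∷ _) (suc zero) (suc (suc r′)) x y _ x∈ y∈ =
      All.lookup (All.lookup (from (∀-rowAt⇔All T sep[]) sepR (suc r′)) x∈) y∈
    ordered (_ ∷ sepT) (suc (suc r)) (suc (suc r′)) x y r<r′ x∈ y∈ =
      from (ordered⇔separated T) sepT (suc r) (suc r′) x y (s≤s⁻¹ r<r′) x∈ y∈
    ordered _ (suc zero)    (suc zero) _ _ (s≤s ()) _ _
    ordered _ (suc (suc r)) (suc zero) _ _ (s≤s ()) _ _
    separated : OrderedRows (R ∷ T) → AllPairs Separated (R ∷ T)
    separated ord =
      to (∀-rowAt⇔All {Separated R} T sep[]) (λ
        { zero     → subst (Separated R) (sym (rowAt-zero T)) sep[]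
        ; (suc r′) → All.tabulate λ x∈ → All.tabulate λ y∈ →
                       ord 1 (suc (suc r′)) _ _ (s≤s (s≤s z≤n)) x∈ y∈ })
      ∷ to (ordered⇔separated T) (λ
        { zero    _ x _ _ x∈ _ → contradiction (subst (x ∈_) (rowAt-zero T) x∈) λ ()
        ; (suc r) (suc r′) x y r<r′ x∈ y∈ →
            ord (suc (suc r)) (suc (suc r′)) x y (s≤s r<r′) x∈ y∈ })

isWCT⇔isTableau : ∀ λ′ T → IsWCT λ′ T ⇔ IsTableau 0 1 λ′ T
isWCT⇔isTableau λ′ T = mk⇔
  (λ w → tableau (shape w) (to positive⇔ (positive w)) (to (∀-∈-rowAt⇔RowsFrom T) (bounded w))
                 (to (∀-rowAt⇔All T []) (rowWeak w)) (to (ordered⇔separated T) (rowsStrict w)))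
  (λ (tableau sh a b s p) → record
     { shape      = sh
     ; positive   = from positive⇔ a
     ; bounded    = from (∀-∈-rowAt⇔RowsFrom T) b
     ; rowWeak    = from (∀-rowAt⇔All T []) s
     ; rowsStrict = from (ordered⇔separated T) p })
  where
    open IsWCT
    positive⇔ : (∀ r x → x ∈ rowAt T r → 1 ≤ x) ⇔ All (All (0 <_)) T
    positive⇔ = ⇔.trans (∀-∈-rowAt⇔RowsFrom T) (RowsFrom-const 1 T)

isContent⇔content : ∀ μ T → IsContent μ T ⇔ Content 0 μ T
isContent⇔content μ T = ⇔.trans
  (mk⇔ (λ c j → c (suc j) (s≤s z≤n)) (λ { c (suc j) _ → c j }))
  (⇔.sym (content⇔at 0 μ T))

wct⇔hasTableau : ∀ λ′ μ → (∃[ T ] (IsWCT λ′ T × IsContent μ T)) ⇔ HasTableau 0 1 λ′ μ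
wct⇔hasTableau λ′ μ = mk⇔ (map₂ λ {T} → to (both T)) (map₂ λ {T} → from (both T))
  where
    both : ∀ T → (IsWCT λ′ T × IsContent μ T) ⇔ (IsTableau 0 1 λ′ T × Content 0 μ T)
    both T = isWCT⇔isTableau λ′ T ×-⇔ isContent⇔content μ T

mainTheorem8 : (λ′ μ : WeakComp) →
    (∃[ T ] (IsWCT λ′ T × IsContent μ T)) ⇔ (Refines (flat μ) (flat λ′) × Dominates μ λ′)
-- Criterion 0 λ′ μ unfolds to the right-hand side, since 0 + i reduces to i.
mainTheorem8 λ′ μ = ⇔.trans (wct⇔hasTableau λ′ μ) (hasTableau⇔criterion 0 0 λ′ μ)
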